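{- Let $\Delta\geq 4$ be an integer and let $G$ be a $\Delta$-regular bipartite graph. Then $P^1(G)\leq\Delta$; that is, there is a proper pushing scheme $\rho:V(G)\to\{0,1,\dots,\Delta\}$ of $G$.
   Context: Graphs are finite, simple and undirected; $\mathbb{N}_0=\{0,1,2,\dots\}$. A function $\rho:V(G)\to\mathbb{N}_0$ is a proper pushing scheme of $G$ if the function $\sigma(u)=(1+\rho(u))d_G(u)+\sum_{v\in N_G(u)}\rho(v)$ satisfies $\sigma(u)\neq\sigma(v)$ for every edge $uv$ of $G$. For a graph $G$ with no connected component of order two, $P^1(G)=\min\{\max_{u\in V(G)}\rho(u): \rho \text{ a proper pushing scheme of } G\}$. -}

module Defs where

open import Data.Nat using (ℕ; _+_; _*_; _≤_)
open import Data.Bool using (Bool; true; false; if_then_else_)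
open import Data.Fin using (Fin)
open import Data.List using (List; map; allFin)
open import Data.Nat.ListAction using (sum)
open import Data.Product using (Σ; _×_)
open import Relation.Binary.PropositionalEquality using (_≡_; _≢_)
open import Relation.Nullary using (¬_)

record Graph (n : ℕ) : Set where
  field
    adj   : Fin n → Fin n → Bool
    sym   : ∀ u v → adj u v ≡ adj v u
    irrefl : ∀ u → adj u u ≡ false

open Graph public

Edge : ∀ {n} → Graph n → Fin n → Fin n → Set
Edge G u v = adj G u v ≡ true

degree : ∀ {n} → Graph n → Fin n → ℕ
degree G u = sum (map (λ v → if adj G u v then 1 else 0) (allFin _))

neighbourSum : ∀ {n} → Graph n → (Fin n → ℕ) → Fin n → ℕ
neighbourSum G ρ u = sum (map (λ v → if adj G u v then ρ v else 0) (allFin _))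

σ : ∀ {n} → Graph n → (Fin n → ℕ) → Fin n → ℕ
σ G ρ u = (1 + ρ u) * degree G u + neighbourSum G ρ u

ProperPushingScheme : ∀ {n} → Graph n → (Fin n → ℕ) → Set
ProperPushingScheme G ρ = ∀ u v → Edge G u v → σ G ρ u ≢ σ G ρ v

Regular : ∀ {n} → ℕ → Graph n → Set
Regular Δ G = ∀ u → degree G u ≡ Δ

Bipartite : ∀ {n} → Graph n → Set
Bipartite {n} G = Σ (Fin n → Bool) λ c → ∀ u v → Edge G u v → c u ≢ c v

-- Colour the two sides of G white and black, and let R be a maximal set of white
-- vertices no two of which have a common neighbour.  Put ρ = 0 on R and on the
-- neighbours of R, and ρ = 1 elsewhere, so that σ(u) = (1 + ρ(u))Δ + k(u) where
-- k(u) counts the neighbours of u with ρ = 1.  A vertex of R has σ = Δ, and by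
-- maximality every other white vertex has a neighbour adjacent to R, so its σ lies
-- in [2Δ, 3Δ).  A black neighbour of R is adjacent to exactly one vertex of R and
-- to Δ - 1 ≥ 1 white vertices outside R, so its σ lies in (Δ, 2Δ); every other
-- black vertex has σ = 3Δ.  The values on the two sides are therefore disjoint.
-- So ρ takes only the values 0 and 1, and Δ ≥ 2 suffices.
module Submission where

open import Defs hiding (sym)
open import Data.Bool using (Bool; true; false; if_then_else_; not)
import Data.Bool as Bool
open import Data.Bool.Properties using (¬-not)
open import Data.Fin using (Fin; zero; suc; _≟_)
open import Data.Fin.Properties using (any?; suc-injective)
open import Data.List using (List; []; _∷_; map; allFin; tabulate)
open import Data.List.Properties using (map-tabulate)
open import Data.List.Membership.Propositional using (_∈_; _∉_; lose; find)
open import Data.List.Membership.Propositional.Properties using (∈-allFin)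
open import Data.List.Relation.Binary.Subset.Propositional using (_⊆_)
open import Data.List.Relation.Binary.Subset.Propositional.Properties using (Any-resp-⊆)
open import Data.List.Relation.Unary.Any as Any using (Any; here; there)
open import Data.Nat using (ℕ; zero; suc; _+_; _*_; _≤_; _<_; z≤n; s≤s)
open import Data.Nat.Properties
  using (≤-refl; ≤-reflexive; ≤-trans; ≤-antisym; <-irrefl; <-≤-trans; ≤-<-trans; <⇒≱;
         +-identityʳ; +-mono-≤; +-mono-<-≤; +-mono-≤-<; +-monoʳ-<; m<m+n; m≤m+n; module ≤-Reasoning)
open import Data.Nat.ListAction using (sum)
open import Data.Product using (Σ; ∃; _×_; _,_; proj₂)
open import Data.Sum as Sum using (_⊎_; inj₁; inj₂)
open import Function using (_∘_)
open import Level using (0ℓ)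
open import Relation.Binary using (Rel; Decidable; Symmetric)
open import Relation.Nullary using (¬_; Dec; yes; no; contradiction)
open import Relation.Nullary.Decidable using (_×-dec_; _⊎-dec_; ¬?; decidable-stable; toSum)
open import Relation.Binary.PropositionalEquality
  using (_≡_; _≢_; refl; sym; trans; cong; cong₂; subst; subst₂; ≢-sym; module ≡-Reasoning)
import Relation.Unary as U

∑ : ∀ {m} → (Fin m → ℕ) → ℕ
∑ f = sum (tabulate f)

∑-allFin : ∀ {m} (f : Fin m → ℕ) → sum (map f (allFin m)) ≡ ∑ f
∑-allFin f = cong sum (map-tabulate (λ i → i) f)

∑-mono-≤ : ∀ {m} {f g : Fin m → ℕ} → (∀ i → f i ≤ g i) → ∑ f ≤ ∑ g
∑-mono-≤ {zero}  f≤g = z≤n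
∑-mono-≤ {suc m} f≤g = +-mono-≤ (f≤g zero) (∑-mono-≤ (f≤g ∘ suc))

∑-mono-< : ∀ {m} {f g : Fin m → ℕ} → (∀ i → f i ≤ g i) → ∀ j → f j < g j → ∑ f < ∑ g
∑-mono-< f≤g zero    fj<gj = +-mono-<-≤ fj<gj (∑-mono-≤ (f≤g ∘ suc))
∑-mono-< f≤g (suc j) fj<gj = +-mono-≤-< (f≤g zero) (∑-mono-< (f≤g ∘ suc) j fj<gj)

∑-zero : ∀ {m} {f : Fin m → ℕ} → (∀ i → f i ≡ 0) → ∑ f ≡ 0
∑-zero {zero}  f≡0 = refl
∑-zero {suc m} f≡0 = cong₂ _+_ (f≡0 zero) (∑-zero (f≡0 ∘ suc))

∑-supported : ∀ {m} {f : Fin m → ℕ} r → (∀ i → i ≢ r → f i ≡ 0) → ∑ f ≡ f r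
∑-supported {f = f} zero f≡0 =
  trans (cong (f zero +_) (∑-zero λ i → f≡0 (suc i) λ ())) (+-identityʳ (f zero))
∑-supported {f = f} (suc r) f≡0 =
  cong₂ _+_ (f≡0 zero λ ()) (∑-supported r λ i i≢r → f≡0 (suc i) (i≢r ∘ suc-injective))

module _ {n} (G : Graph n) where

  Edge-sym : ∀ {u v} → Edge G u v → Edge G v u
  Edge-sym {u} {v} e = trans (Graph.sym G v u) e

  Edge? : ∀ u v → Dec (Edge G u v)
  Edge? u v = adj G u v Bool.≟ true

  CommonNeighbour : Rel (Fin n) 0ℓ
  CommonNeighbour w r = ∃ λ t → Edge G w t × Edge G r t

  commonNeighbour? : Decidable CommonNeighbour
  commonNeighbour? w r = any? λ t → Edge? w t ×-dec Edge? r t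

  CommonNeighbour-sym : Symmetric CommonNeighbour
  CommonNeighbour-sym (t , e , e′) = t , e′ , e

  private
    weight : (Fin n → ℕ) → Fin n → Fin n → ℕ
    weight ρ u v = if adj G u v then ρ v else 0

    weight-mono-≤ : ∀ {ρ τ u} v → (Edge G u v → ρ v ≤ τ v) → weight ρ u v ≤ weight τ u v
    weight-mono-≤ {u = u} v ρ≤τ with adj G u v
    ... | true  = ρ≤τ refl
    ... | false = z≤n

    weight-mono-< : ∀ {ρ τ u w} → Edge G u w → ρ w < τ w → weight ρ u w < weight τ u w
    weight-mono-< e ρ<τ rewrite e = ρ<τ

    weight-zero : ∀ {ρ u} v → (Edge G u v → ρ v ≡ 0) → weight ρ u v ≡ 0
    weight-zero {u = u} v ρ≡0 with adj G u v
    ... | true  = ρ≡0 refl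
    ... | false = refl

  neighbourSum-mono-≤ : ∀ {ρ τ u} → (∀ {v} → Edge G u v → ρ v ≤ τ v) →
                        neighbourSum G ρ u ≤ neighbourSum G τ u
  neighbourSum-mono-≤ {ρ} {τ} {u} ρ≤τ =
    subst₂ _≤_ (sym (∑-allFin (weight ρ u))) (sym (∑-allFin (weight τ u)))
      (∑-mono-≤ λ v → weight-mono-≤ {ρ} {τ} v ρ≤τ)

  neighbourSum-mono-< : ∀ {ρ τ u w} → (∀ {v} → Edge G u v → ρ v ≤ τ v) →
                        Edge G u w → ρ w < τ w → neighbourSum G ρ u < neighbourSum G τ u
  neighbourSum-mono-< {ρ} {τ} {u} {w} ρ≤τ e ρ<τ =
    subst₂ _<_ (sym (∑-allFin (weight ρ u))) (sym (∑-allFin (weight τ u)))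
      (∑-mono-< (λ v → weight-mono-≤ {ρ} {τ} v ρ≤τ) w (weight-mono-< {ρ} {τ} e ρ<τ))

  neighbourSum-zero : ∀ {ρ u} → (∀ {v} → Edge G u v → ρ v ≡ 0) → neighbourSum G ρ u ≡ 0
  neighbourSum-zero {ρ} {u} ρ≡0 = trans (∑-allFin (weight ρ u)) (∑-zero λ v → weight-zero {ρ} v ρ≡0)

  neighbourSum-degree : ∀ {ρ u} → (∀ {v} → Edge G u v → ρ v ≡ 1) → neighbourSum G ρ u ≡ degree G u
  neighbourSum-degree ρ≡1 =
    ≤-antisym (neighbourSum-mono-≤ (≤-reflexive ∘ ρ≡1))
              (neighbourSum-mono-≤ (≤-reflexive ∘ sym ∘ ρ≡1))

  degree-≤-1 : ∀ {u} r → (∀ {v} → Edge G u v → v ≡ r) → degree G u ≤ 1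
  degree-≤-1 {u} r onlyR = begin
    degree G u              ≡⟨ ∑-allFin (weight (λ _ → 1) u) ⟩
    ∑ (weight (λ _ → 1) u)  ≡⟨ ∑-supported r vanishes ⟩
    weight (λ _ → 1) u r    ≤⟨ at-most-one ⟩
    1                       ∎
    where
    open ≤-Reasoning
    vanishes : ∀ v → v ≢ r → weight (λ _ → 1) u v ≡ 0
    vanishes v v≢r = weight-zero {λ _ → 1} v λ e → contradiction (onlyR e) v≢r
    at-most-one : weight (λ _ → 1) u r ≤ 1
    at-most-one with adj G u r
    ... | true  = ≤-refl
    ... | false = z≤n

  another-neighbour : ∀ {u} → 2 ≤ degree G u → ∀ r → ∃ λ v → Edge G u v × v ≢ r
  another-neighbour {u} 2≤deg r with any? (λ v → Edge? u v ×-dec ¬? (v ≟ r))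
  ... | yes found = found
  ... | no none   = contradiction (degree-≤-1 r onlyR) (<⇒≱ 2≤deg)
    where
    onlyR : ∀ {v} → Edge G u v → v ≡ r
    onlyR {v} e = decidable-stable (v ≟ r) λ v≢r → none (v , e , v≢r)

  σ-regular : ∀ {Δ} → Regular Δ G → ∀ ρ u → σ G ρ u ≡ (1 + ρ u) * Δ + neighbourSum G ρ u
  σ-regular reg ρ u = cong (λ d → (1 + ρ u) * d + neighbourSum G ρ u) (reg u)

record IsMaximalIndependent {n} (_~_ : Rel (Fin n) 0ℓ) (P : U.Pred (Fin n) 0ℓ) (R : List (Fin n)) : Set where
  field
    members : ∀ {r} → r ∈ R → P r
    independent : ∀ {r r′} → r ∈ R → r′ ∈ R → r ~ r′ → r ≡ r′
    maximal : ∀ {w} → P w → w ∈ R ⊎ Any (w ~_) R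

module Greedy {n} {_~_ : Rel (Fin n) 0ℓ} (_~?_ : Decidable _~_) (~-sym : Symmetric _~_)
              {P : U.Pred (Fin n) 0ℓ} (P? : U.Decidable P) where

  Addable : List (Fin n) → Fin n → Set
  Addable R w = P w × ¬ Any (w ~_) R

  addable? : ∀ R w → Dec (Addable R w)
  addable? R w = P? w ×-dec ¬? (Any.any? (w ~?_) R)

  greedy : List (Fin n) → List (Fin n)
  greedy []       = []
  greedy (w ∷ ws) with addable? (greedy ws) w
  ... | yes _ = w ∷ greedy ws
  ... | no _  = greedy ws

  greedy-⊆-∷ : ∀ w ws → greedy ws ⊆ greedy (w ∷ ws)
  greedy-⊆-∷ w ws r∈ with addable? (greedy ws) w
  ... | yes _ = there r∈
  ... | no _  = r∈

  greedy-members : ∀ ws {r} → r ∈ greedy ws → P r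
  greedy-members (w ∷ ws) r∈ with addable? (greedy ws) w
  greedy-members (w ∷ ws) (here refl) | yes (Pw , _) = Pw
  greedy-members (w ∷ ws) (there r∈)  | yes _        = greedy-members ws r∈
  greedy-members (w ∷ ws) r∈          | no _         = greedy-members ws r∈

  greedy-independent : ∀ ws {r r′} → r ∈ greedy ws → r′ ∈ greedy ws → r ~ r′ → r ≡ r′
  greedy-independent (w ∷ ws) r∈ r′∈ r~r′ with addable? (greedy ws) w
  greedy-independent (w ∷ ws) (here refl) (here refl) _    | yes _          = refl
  greedy-independent (w ∷ ws) (here refl) (there r′∈) w~r′ | yes (_ , free) =
    contradiction (lose r′∈ w~r′) free
  greedy-independent (w ∷ ws) (there r∈) (here refl) r~w   | yes (_ , free) =
    contradiction (lose r∈ (~-sym r~w)) free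
  greedy-independent (w ∷ ws) (there r∈) (there r′∈) r~r′  | yes _ =
    greedy-independent ws r∈ r′∈ r~r′
  greedy-independent (w ∷ ws) r∈ r′∈ r~r′                 | no _ =
    greedy-independent ws r∈ r′∈ r~r′

  greedy-maximal : ∀ ws {w} → w ∈ ws → P w → w ∈ greedy ws ⊎ Any (w ~_) (greedy ws)
  greedy-maximal (x ∷ ws) (there w∈) Pw =
    Sum.map (greedy-⊆-∷ x ws) (Any-resp-⊆ (greedy-⊆-∷ x ws)) (greedy-maximal ws w∈ Pw)
  greedy-maximal (w ∷ ws) (here refl) Pw with addable? (greedy ws) w
  ... | yes _   = inj₁ (here refl)
  ... | no ¬add = inj₂ (decidable-stable (Any.any? (w ~?_) (greedy ws)) λ free → ¬add (Pw , free))

  maximalIndependent : ∃ (IsMaximalIndependent _~_ P)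
  maximalIndependent = greedy (allFin n) , record
    { members     = greedy-members (allFin n)
    ; independent = greedy-independent (allFin n)
    ; maximal     = greedy-maximal (allFin n) (∈-allFin _)
    }

Band : ℕ → Bool → ℕ → Set
Band Δ false x = x ≡ Δ ⊎ (Δ + Δ ≤ x × x < Δ + Δ + Δ)
Band Δ true  x = (Δ < x × x < Δ + Δ) ⊎ x ≡ Δ + Δ + Δ

Band-disjoint : ∀ {Δ x y} → 0 < Δ → Band Δ false x → Band Δ true y → x ≢ y
Band-disjoint _   (inj₁ refl) (inj₁ (Δ<y , _)) refl = <-irrefl refl Δ<y
Band-disjoint {Δ} 0<Δ (inj₁ refl) (inj₂ Δ≡3Δ) refl =
  <-irrefl Δ≡3Δ (<-≤-trans (m<m+n Δ 0<Δ) (m≤m+n (Δ + Δ) Δ))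
Band-disjoint _ (inj₂ (2Δ≤x , _)) (inj₁ (_ , x<2Δ)) refl = <-irrefl refl (≤-<-trans 2Δ≤x x<2Δ)
Band-disjoint _ (inj₂ (_ , x<3Δ)) (inj₂ refl) refl = <-irrefl refl x<3Δ

Band-separates : ∀ {Δ x y} → 0 < Δ → ∀ a b → a ≢ b → Band Δ a x → Band Δ b y → x ≢ y
Band-separates 0<Δ false true  _   x∈ y∈ = Band-disjoint 0<Δ x∈ y∈
Band-separates 0<Δ true  false _   x∈ y∈ = ≢-sym (Band-disjoint 0<Δ y∈ x∈)
Band-separates _   false false a≢b _  _  = contradiction refl a≢b
Band-separates _   true  true  a≢b _  _  = contradiction refl a≢b

module PushingScheme {n} (G : Graph n) (c : Fin n → Bool) (bipartite : ∀ u v → Edge G u v → c u ≢ c v)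
                     {R : List (Fin n)}
                     (isMax : IsMaximalIndependent (CommonNeighbour G) (λ w → c w ≡ false) R) where

  open IsMaximalIndependent isMax
  open import Data.List.Membership.DecPropositional (_≟_ {n}) using (_∈?_)

  edge-flips : ∀ {u v} → Edge G u v → c v ≡ not (c u)
  edge-flips {u} {v} e = ¬-not (≢-sym (bipartite u v e))

  Near : U.Pred (Fin n) 0ℓ
  Near v = Any (Edge G v) R

  near? : U.Decidable Near
  near? v = Any.any? (Edge? G v) R

  ρ : Fin n → ℕ
  ρ v with v ∈? R ⊎-dec near? v
  ... | yes _ = 0
  ... | no _  = 1

  ρ≤1 : ∀ v → ρ v ≤ 1
  ρ≤1 v with v ∈? R ⊎-dec near? v
  ... | yes _ = z≤n
  ... | no _  = ≤-refl

  ρ-inside : ∀ {v} → v ∈ R ⊎ Near v → ρ v ≡ 0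
  ρ-inside {v} inside with v ∈? R ⊎-dec near? v
  ... | yes _      = refl
  ... | no outside = contradiction inside outside

  ρ-outside : ∀ {v} → ¬ (v ∈ R ⊎ Near v) → ρ v ≡ 1
  ρ-outside {v} outside with v ∈? R ⊎-dec near? v
  ... | yes inside = contradiction inside outside
  ... | no _       = refl

  Near-black : ∀ {v} → Near v → c v ≡ true
  Near-black near with find near
  ... | r , r∈R , e = trans (edge-flips (Edge-sym G e)) (cong not (members r∈R))

  ρ-white : ∀ {v} → c v ≡ false → v ∉ R → ρ v ≡ 1
  ρ-white cv v∉R = ρ-outside Sum.[ v∉R , (λ near → contradiction (trans (sym (Near-black near)) cv) λ ()) ]

  ρ-black : ∀ {v} → c v ≡ true → ¬ Near v → ρ v ≡ 1
  ρ-black cv ¬near = ρ-outside Sum.[ (λ v∈R → contradiction (trans (sym cv) (members v∈R)) λ ()) , ¬near ]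

  module _ {Δ} (reg : Regular Δ G) (2≤Δ : 2 ≤ Δ) where

    σ-ρ≡0 : ∀ {u} → ρ u ≡ 0 → σ G ρ u ≡ Δ + neighbourSum G ρ u
    σ-ρ≡0 {u} ρu≡0 = begin
      σ G ρ u                                ≡⟨ σ-regular G reg ρ u ⟩
      (1 + ρ u) * Δ + neighbourSum G ρ u     ≡⟨ cong (λ k → (1 + k) * Δ + neighbourSum G ρ u) ρu≡0 ⟩
      Δ + 0 + neighbourSum G ρ u             ≡⟨ cong (_+ neighbourSum G ρ u) (+-identityʳ Δ) ⟩
      Δ + neighbourSum G ρ u                 ∎
      where open ≡-Reasoning

    σ-ρ≡1 : ∀ {u} → ρ u ≡ 1 → σ G ρ u ≡ Δ + Δ + neighbourSum G ρ u
    σ-ρ≡1 {u} ρu≡1 = begin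
      σ G ρ u                                ≡⟨ σ-regular G reg ρ u ⟩
      (1 + ρ u) * Δ + neighbourSum G ρ u     ≡⟨ cong (λ k → (1 + k) * Δ + neighbourSum G ρ u) ρu≡1 ⟩
      Δ + (Δ + 0) + neighbourSum G ρ u       ≡⟨ cong (λ x → Δ + x + neighbourSum G ρ u) (+-identityʳ Δ) ⟩
      Δ + Δ + neighbourSum G ρ u             ∎
      where open ≡-Reasoning

    neighbourSum<Δ : ∀ {u w} → Edge G u w → ρ w ≡ 0 → neighbourSum G ρ u < Δ
    neighbourSum<Δ {u} e ρw≡0 = subst (neighbourSum G ρ u <_) (reg u)
      (neighbourSum-mono-< G {τ = λ _ → 1} (λ {v} _ → ρ≤1 v) e (≤-reflexive (cong suc ρw≡0)))

    σ-R : ∀ {u} → u ∈ R → σ G ρ u ≡ Δ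
    σ-R {u} u∈R = begin
      σ G ρ u                 ≡⟨ σ-ρ≡0 (ρ-inside (inj₁ u∈R)) ⟩
      Δ + neighbourSum G ρ u  ≡⟨ cong (Δ +_) (neighbourSum-zero G λ e → ρ-inside (inj₂ (lose u∈R (Edge-sym G e)))) ⟩
      Δ + 0                   ≡⟨ +-identityʳ Δ ⟩
      Δ                       ∎
      where open ≡-Reasoning

    σ-white∖R : ∀ {u} → c u ≡ false → u ∉ R → Δ + Δ ≤ σ G ρ u × σ G ρ u < Δ + Δ + Δ
    σ-white∖R {u} cu u∉R with maximal cu
    ... | inj₁ u∈R     = contradiction u∈R u∉R
    ... | inj₂ clashes with find clashes
    ... | r , r∈R , t , ut , rt =
      subst (Δ + Δ ≤_) (sym σ≡) (m≤m+n (Δ + Δ) _) ,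
      subst (_< Δ + Δ + Δ) (sym σ≡) (+-monoʳ-< (Δ + Δ) (neighbourSum<Δ ut ρt≡0))
      where
      σ≡ : σ G ρ u ≡ Δ + Δ + neighbourSum G ρ u
      σ≡ = σ-ρ≡1 (ρ-white cu u∉R)
      ρt≡0 : ρ t ≡ 0
      ρt≡0 = ρ-inside (inj₂ (lose r∈R (Edge-sym G rt)))

    σ-near : ∀ {u} → Near u → Δ < σ G ρ u × σ G ρ u < Δ + Δ
    σ-near {u} near with find near
    ... | r , r∈R , ur with another-neighbour G (subst (2 ≤_) (sym (reg u)) 2≤Δ) r
    ... | v , uv , v≢r =
      subst (Δ <_) (sym σ≡) (m<m+n Δ 0<s) ,
      subst (_< Δ + Δ) (sym σ≡) (+-monoʳ-< Δ (neighbourSum<Δ ur (ρ-inside (inj₁ r∈R))))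
      where
      σ≡ : σ G ρ u ≡ Δ + neighbourSum G ρ u
      σ≡ = σ-ρ≡0 (ρ-inside (inj₂ near))
      v∉R : v ∉ R
      v∉R v∈R = v≢r (independent v∈R r∈R (u , Edge-sym G uv , Edge-sym G ur))
      ρv≡1 : ρ v ≡ 1
      ρv≡1 = ρ-white (trans (edge-flips uv) (cong not (Near-black near))) v∉R
      0<s : 0 < neighbourSum G ρ u
      0<s = subst (_< neighbourSum G ρ u) (neighbourSum-zero G {ρ = λ _ → 0} λ _ → refl)
              (neighbourSum-mono-< G (λ _ → z≤n) uv (≤-reflexive (sym ρv≡1)))

    σ-far : ∀ {u} → c u ≡ true → ¬ Near u → σ G ρ u ≡ Δ + Δ + Δ
    σ-far {u} cu ¬near = begin
      σ G ρ u                     ≡⟨ σ-ρ≡1 (ρ-black cu ¬near) ⟩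
      Δ + Δ + neighbourSum G ρ u  ≡⟨ cong (Δ + Δ +_) (trans (neighbourSum-degree G ρv≡1) (reg u)) ⟩
      Δ + Δ + Δ                   ∎
      where
      open ≡-Reasoning
      ρv≡1 : ∀ {v} → Edge G u v → ρ v ≡ 1
      ρv≡1 e = ρ-white (trans (edge-flips e) (cong not cu)) (λ v∈R → ¬near (lose v∈R e))

    σ-band : ∀ u → Band Δ (c u) (σ G ρ u)
    σ-band u with c u in cu
    ... | false = Sum.map σ-R (σ-white∖R cu) (toSum (u ∈? R))
    ... | true  = Sum.map σ-near (σ-far cu) (toSum (near? u))

    proper : ProperPushingScheme G ρ
    proper u v e =
      Band-separates (≤-trans (s≤s z≤n) 2≤Δ) (c u) (c v) (bipartite u v e) (σ-band u) (σ-band v)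

proposition1 : (Δ : ℕ) → 4 ≤ Δ → (n : ℕ) → (G : Graph n) →
    Regular Δ G → Bipartite G →
    Σ (Fin n → ℕ) λ ρ → ((u : Fin n) → ρ u ≤ Δ) × ProperPushingScheme G ρ
proposition1 Δ 4≤Δ n G reg (c , bipartite) = ρ , (λ u → ≤-trans (ρ≤1 u) 1≤Δ) , proper reg 2≤Δ
  where
  open Greedy (commonNeighbour? G) (CommonNeighbour-sym G) (λ w → c w Bool.≟ false)
  open PushingScheme G c bipartite (proj₂ maximalIndependent)
  2≤Δ : 2 ≤ Δ
  2≤Δ = ≤-trans (s≤s (s≤s z≤n)) 4≤Δ
  1≤Δ : 1 ≤ Δ
  1≤Δ = ≤-trans (s≤s z≤n) 2≤Δ
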